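{- Let $a$ be an even positive integer and let $L\neq L'$ be two adjacent levels of $[6a+2]^2$. Then the T-region contains a gray block that is a lift from $L$ to $L'$ and a white block that is a lift from $L$ to $L'$.
   Context: $[N]=\{0,\dots,N-1\}$, $N=6a+2$. The $(a,1)$ knight's graph on $[N]^2$ has vertex set $[N]^2$, with $(x,y)\sim(x',y')$ iff $\{|x-x'|,|y-y'|\}=\{a,1\}$. A unit is a set $\{(i,j),(i+1,j),(i,j+1),(i+1,j+1)\}\subseteq[N]^2$ with $i,j$ even; units $U,U'$ are equivalent if $U'=U+(ka,la)$ for integers $k,l$. For $(i,j)\in[a]^2$, the level $L_{ij}$ is the connected component containing $(i,j)$ of the subgraph of the knight's graph induced by the union of all units equivalent to the unit containing $(i,j)$; levels are adjacent if some vertex of one is adjacent in the knight's graph to some vertex of the other. For $i,j\in\{0,\dots,6\}$ the block $B_{ij}$ is $\{(x,y)\in[N]^2: ia\leq x\leq (i+1)a-1,\ ja\leq y\leq (j+1)a-1\}$; it is gray if $i+j$ is even and white otherwise. If $V\in L$ and $V'\in L'$ are adjacent in the knight's graph, with $L\neq L'$ levels, the block containing $V$ is called a lift from $L$ to $L'$. The T-region is $\{B_{ij}: i,j\in\{2,3\}\}$. -}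

module Defs where

open import Data.Nat using (ℕ; suc; _+_; _*_; _≤_; _<_; ∣_-_∣)
open import Data.Nat.Divisibility using (_∣_)
open import Data.Integer as ℤ using (ℤ; +_)
open import Data.Product using (_×_; _,_; ∃; ∃-syntax)
open import Data.Sum using (_⊎_)
open import Relation.Binary.PropositionalEquality using (_≡_)
open import Relation.Nullary using (¬_)
open import Function.Bundles using (_⇔_)

-- points of ℕ², membership in [N]² is imposed separately
Pt : Set
Pt = ℕ × ℕ

module _ (a : ℕ) where

  N : ℕ
  N = 6 * a + 2

  InGrid : Pt → Set
  InGrid (x , y) = x < N × y < N

  Knight : Pt → Pt → Set
  Knight (x , y) (x' , y') =
    InGrid (x , y) × InGrid (x' , y') ×
    ((∣ x - x' ∣ ≡ a × ∣ y - y' ∣ ≡ 1) ⊎ (∣ x - x' ∣ ≡ 1 × ∣ y - y' ∣ ≡ a))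

  -- a unit, represented by its lower-left corner (i,j): i, j even and
  -- {(i,j),(i+1,j),(i,j+1),(i+1,j+1)} ⊆ [N]²
  IsUnit : Pt → Set
  IsUnit (i , j) = 2 ∣ i × 2 ∣ j × suc i < N × suc j < N

  InUnit : Pt → Pt → Set
  InUnit (i , j) (x , y) = i ≤ x × x ≤ suc i × j ≤ y × y ≤ suc j

  UnitEquiv : Pt → Pt → Set
  UnitEquiv (i , j) (i' , j') =
    ∃[ k ] ∃[ l ] ((+ i') ≡ (+ i) ℤ.+ k ℤ.* (+ a) × (+ j') ≡ (+ j) ℤ.+ l ℤ.* (+ a))

  InUnion : Pt → Pt → Set
  InUnion p v =
    ∃[ U ] (IsUnit U × InUnit U p × ∃[ U' ] (IsUnit U' × UnitEquiv U U' × InUnit U' v))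

  data Reach (S : Pt → Set) : Pt → Pt → Set where
    here : ∀ {u} → S u → Reach S u u
    step : ∀ {u v w} → Reach S u v → S w → Knight v w → Reach S u w

  Level : Pt → Pt → Set
  Level p v = Reach (InUnion p) p v

  IsLevelIndex : Pt → Set
  IsLevelIndex (i , j) = i < a × j < a

  SameLevel : Pt → Pt → Set
  SameLevel p q = ∀ v → (Level p v ⇔ Level q v)

  LevelsAdjacent : Pt → Pt → Set
  LevelsAdjacent p q = ∃[ V ] ∃[ V' ] (Level p V × Level q V' × Knight V V')

  InBlock : Pt → Pt → Set
  InBlock (bi , bj) (x , y) =
    InGrid (x , y) × bi * a ≤ x × x < suc bi * a × bj * a ≤ y × y < suc bj * a

  IsLift : Pt → Pt → Pt → Set
  IsLift p q B =
    ∃[ V ] ∃[ V' ] (Level p V × Level q V' × Knight V V' × InBlock B V)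

Gray : Pt → Set
Gray (i , j) = 2 ∣ (i + j)

White : Pt → Set
White (i , j) = ¬ (2 ∣ (i + j))

InT : Pt → Set
InT (i , j) = (i ≡ 2 ⊎ i ≡ 3) × (j ≡ 2 ⊎ j ≡ 3)

-- For even a, a level L is closed under the knight moves (x , y) ↦ (x ± a , mate y)
-- and (x , y) ↦ (mate x , y ± a), where mate swaps 2k and 2k+1: the unit containing
-- (x , y), shifted by a, is equivalent to it and contains the image point. Two such
-- moves translate L by 2a along an axis, so an adjacent pair V ∈ L, V' ∈ L' can be
-- translated until V lies in the 2a × 2a square formed by the T-region. One further
-- move of the second kind, applied to both V and V', carries the pair from one row of
-- the T-region to the other within the same column, and the two blocks so obtained
-- have opposite colours.
module Submission where

open import Defs
open import Data.Nat using (ℕ; zero; suc; _+_; _*_; _≤_; _<_; s≤s; s≤s⁻¹; z<s; ∣_-_∣; _<?_)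
open import Data.Nat.Properties
open import Data.Nat.Divisibility using (_∣_; divides; ∣1⇒≡1; ∣m+n∣m⇒∣n; ∣m∣n⇒∣m+n; ∣n⇒∣m*n)
open import Data.Nat.Induction using (<-wellFounded)
open import Data.Integer as ℤ using (+_)
import Data.Integer.Properties as ℤ
open import Data.Integer.Tactic.RingSolver using (solve-∀)
open import Data.Product using (_×_; _,_; ∃; ∃₂; ∃-syntax; proj₁; proj₂; swap)
open import Data.Sum using (_⊎_; inj₁; inj₂)
open import Function using (_∘_)
open import Induction.WellFounded using (Acc; acc)
open import Relation.Binary.PropositionalEquality
open import Relation.Nullary using (¬_; yes; no; contradiction)

private variable
  m n o i j k x y x' y' d e : ℕ
  p q u v B V V' : Pt

2∤1+n : 2 ∣ n → ¬ 2 ∣ suc n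
2∤1+n {n} 2∣n 2∣1+n with ∣1⇒≡1 (∣m+n∣m⇒∣n (subst (2 ∣_) (+-comm 1 n) 2∣1+n) 2∣n)
... | ()

even<even⇒1+< : 2 ∣ m → 2 ∣ n → m < n → suc m < n
even<even⇒1+< 2∣m 2∣n m<n with m≤n⇒m<n∨m≡n m<n
... | inj₁ 1+m<n = 1+m<n
... | inj₂ refl  = contradiction 2∣n (2∤1+n 2∣m)

≤⇒∃[o]n≡o+m : m ≤ n → ∃ λ o → n ≡ o + m
≤⇒∃[o]n≡o+m m≤n = _ , sym (m∸n+n≡m m≤n)

∣m-n∣≡o⇒n≡m+o⊎m≡n+o : ∣ m - n ∣ ≡ o → n ≡ m + o ⊎ m ≡ n + o
∣m-n∣≡o⇒n≡m+o⊎m≡n+o {zero}  {n}     eq = inj₁ eq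
∣m-n∣≡o⇒n≡m+o⊎m≡n+o {suc m} {zero}  eq = inj₂ eq
∣m-n∣≡o⇒n≡m+o⊎m≡n+o {suc m} {suc n} eq with ∣m-n∣≡o⇒n≡m+o⊎m≡n+o {m} {n} eq
... | inj₁ n≡m+o = inj₁ (cong suc n≡m+o)
... | inj₂ m≡n+o = inj₂ (cong suc m≡n+o)

∣m-n∣≡o⇒n≤m+o : ∣ m - n ∣ ≡ o → n ≤ m + o
∣m-n∣≡o⇒n≤m+o {m} {n} {o} eq with ∣m-n∣≡o⇒n≡m+o⊎m≡n+o {m} {n} eq
... | inj₁ refl = ≤-refl
... | inj₂ refl = ≤-trans (m≤m+n n o) (m≤m+n (n + o) o)

∣m+o-n+o∣≡∣m-n∣ : ∀ m n o → ∣ m + o - n + o ∣ ≡ ∣ m - n ∣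
∣m+o-n+o∣≡∣m-n∣ m n o rewrite +-comm m o | +-comm n o = ∣m+n-m+o∣≡∣n-o∣ o m n

-- The other point of the aligned pair {2k, 2k+1} containing n.
mate : ℕ → ℕ
mate zero          = 1
mate (suc zero)    = 0
mate (suc (suc n)) = suc (suc (mate n))

mate-involutive : ∀ n → mate (mate n) ≡ n
mate-involutive zero          = refl
mate-involutive (suc zero)    = refl
mate-involutive (suc (suc n)) = cong (suc ∘ suc) (mate-involutive n)

∣n-mate[n]∣≡1 : ∀ n → ∣ n - mate n ∣ ≡ 1
∣n-mate[n]∣≡1 zero          = refl
∣n-mate[n]∣≡1 (suc zero)    = refl
∣n-mate[n]∣≡1 (suc (suc n)) = ∣n-mate[n]∣≡1 n

mate-*2+ : ∀ k n → mate (k * 2 + n) ≡ k * 2 + mate n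
mate-*2+ zero    n = refl
mate-*2+ (suc k) n = cong (suc ∘ suc) (mate-*2+ k n)

mate-+even : 2 ∣ m → ∀ n → mate (n + m) ≡ mate n + m
mate-+even {m} (divides k refl) n = begin
  mate (n + k * 2)  ≡⟨ cong mate (+-comm n (k * 2)) ⟩
  mate (k * 2 + n)  ≡⟨ mate-*2+ k n ⟩
  k * 2 + mate n    ≡⟨ +-comm (k * 2) (mate n) ⟩
  mate n + k * 2    ∎
  where open ≡-Reasoning

even≤⇒≤mate : 2 ∣ m → m ≤ n → m ≤ mate n
even≤⇒≤mate {m} 2∣m m≤n with ≤⇒∃[o]n≡o+m m≤n
... | o , refl rewrite mate-+even 2∣m o = m≤n+m m (mate o)

<even⇒mate< : 2 ∣ m → n < m → mate n < m
<even⇒mate< {m} {n} 2∣m n<m with mate n <? m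
... | yes mate[n]<m = mate[n]<m
... | no  mate[n]≮m =
  contradiction (subst (m ≤_) (mate-involutive n) (even≤⇒≤mate 2∣m (≮⇒≥ mate[n]≮m))) (<⇒≱ n<m)

mate-preserves-even-∣-∣ : 2 ∣ d → ∣ m - n ∣ ≡ d → ∣ mate m - mate n ∣ ≡ d
mate-preserves-even-∣-∣ {d} {m} {n} 2∣d eq with ∣m-n∣≡o⇒n≡m+o⊎m≡n+o {m} {n} eq
... | inj₁ refl rewrite mate-+even 2∣d m = ∣m-m+n∣≡n (mate m) d
... | inj₂ refl rewrite mate-+even 2∣d n = trans (∣-∣-comm (mate n + d) (mate n)) (∣m-m+n∣≡n (mate n) d)

reach-target : ∀ {a} {S : Pt → Set} → Reach a S u v → S v
reach-target (here s)     = s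
reach-target (step _ s _) = s

knight-swap : ∀ {a} → Knight a u v → Knight a (swap u) (swap v)
knight-swap (u∈ , v∈ , inj₁ (dx , dy)) = swap u∈ , swap v∈ , inj₂ (dy , dx)
knight-swap (u∈ , v∈ , inj₂ (dx , dy)) = swap u∈ , swap v∈ , inj₁ (dy , dx)

reach-swap : ∀ {a} {S T : Pt → Set} → (∀ {w} → S w → T (swap w)) →
             Reach a S u v → Reach a T (swap u) (swap v)
reach-swap S⇒T (here s)       = here (S⇒T s)
reach-swap S⇒T (step r s uv)  = step (reach-swap S⇒T r) (S⇒T s) (knight-swap uv)

module _ (a : ℕ) (2∣a : 2 ∣ a) where

  2∣N : 2 ∣ N a
  2∣N = ∣m∣n⇒∣m+n (∣n⇒∣m*n 6 2∣a) (divides 1 refl)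

  k*a<N : k ≤ 6 → k * a < N a
  k*a<N k≤6 = ≤-<-trans (*-monoˡ-≤ a k≤6) (m<m+n (6 * a) z<s)

  x+2a≡x+a+a : ∀ x → x + 2 * a ≡ x + a + a
  x+2a≡x+a+a x = trans (cong (λ t → x + (a + t)) (+-identityʳ a)) (sym (+-assoc x a a))

  unitEquiv-+a : UnitEquiv a u (i , j) → UnitEquiv a u (i + a , j)
  unitEquiv-+a {u = (i₀ , _)} {i = i} (k , l , i≡ , j≡) = k ℤ.+ + 1 , l , i+a≡ , j≡
    where
      open ≡-Reasoning
      shift : ∀ c k a → c ℤ.+ k ℤ.* a ℤ.+ a ≡ c ℤ.+ (k ℤ.+ + 1) ℤ.* a
      shift = solve-∀
      i+a≡ : + (i + a) ≡ + i₀ ℤ.+ (k ℤ.+ + 1) ℤ.* + a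
      i+a≡ = begin
        + (i + a)                   ≡⟨ ℤ.pos-+ i a ⟩
        + i ℤ.+ + a                 ≡⟨ cong (ℤ._+ + a) i≡ ⟩
        + i₀ ℤ.+ k ℤ.* + a ℤ.+ + a  ≡⟨ shift (+ i₀) k (+ a) ⟩
        + i₀ ℤ.+ (k ℤ.+ + 1) ℤ.* + a ∎

  unitEquiv-∸a : UnitEquiv a u (i + a , j) → UnitEquiv a u (i , j)
  unitEquiv-∸a {u = (i₀ , _)} {i = i} (k , l , i+a≡ , j≡) = k ℤ.- + 1 , l , i≡ , j≡
    where
      open ≡-Reasoning
      add-sub : ∀ c a → c ≡ c ℤ.+ a ℤ.- a
      add-sub = solve-∀
      unshift : ∀ c k a → c ℤ.+ k ℤ.* a ℤ.- a ≡ c ℤ.+ (k ℤ.- + 1) ℤ.* a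
      unshift = solve-∀
      i≡ : + i ≡ + i₀ ℤ.+ (k ℤ.- + 1) ℤ.* + a
      i≡ = begin
        + i                         ≡⟨ add-sub (+ i) (+ a) ⟩
        + i ℤ.+ + a ℤ.- + a         ≡⟨ cong (ℤ._- + a) (trans (sym (ℤ.pos-+ i a)) i+a≡) ⟩
        + i₀ ℤ.+ k ℤ.* + a ℤ.- + a  ≡⟨ unshift (+ i₀) k (+ a) ⟩
        + i₀ ℤ.+ (k ℤ.- + 1) ℤ.* + a ∎

  mate-inUnit : 2 ∣ j → j ≤ y → y ≤ suc j → j ≤ mate y × mate y ≤ suc j
  mate-inUnit 2∣j j≤y y≤1+j =
    even≤⇒≤mate 2∣j j≤y , s≤s⁻¹ (<even⇒mate< (∣m∣n⇒∣m+n (divides 1 refl) 2∣j) (s≤s y≤1+j))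

  -- Both corners are even, so the unit containing x + a cannot start below a.
  a≤corner : 2 ∣ i → x + a ≤ suc i → a ≤ i
  a≤corner {i} {x} 2∣i x+a≤1+i = ≮⇒≥ λ i<a →
    <⇒≱ (≤-<-trans x+a≤1+i (even<even⇒1+< 2∣i 2∣a i<a)) (m≤n+m a x)

  inUnion⇒inGrid : InUnion a p v → InGrid a v
  inUnion⇒inGrid (_ , _ , _ , _ , (_ , _ , 1+i<N , 1+j<N) , _ , (_ , x≤1+i , _ , y≤1+j)) =
    ≤-<-trans x≤1+i 1+i<N , ≤-<-trans y≤1+j 1+j<N

  inUnion-stepʳ : InUnion a p (x , y) → x + a < N a → InUnion a p (x + a , mate y)
  inUnion-stepʳ (U , U-unit , p∈U , (i , j) , (2∣i , 2∣j , _ , 1+j<N) , U~ij , (i≤x , x≤1+i , j≤y , y≤1+j))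
                x+a<N =
    U , U-unit , p∈U , (i + a , j) ,
    (2∣i+a , 2∣j , even<even⇒1+< 2∣i+a 2∣N (≤-<-trans (+-monoˡ-≤ a i≤x) x+a<N) , 1+j<N) ,
    unitEquiv-+a U~ij ,
    (+-monoˡ-≤ a i≤x , +-monoˡ-≤ a x≤1+i , mate-inUnit 2∣j j≤y y≤1+j)
    where
      2∣i+a : 2 ∣ i + a
      2∣i+a = ∣m∣n⇒∣m+n 2∣i 2∣a

  inUnion-stepˡ : InUnion a p (x + a , y) → InUnion a p (x , mate y)
  inUnion-stepˡ {x = x}
    (U , U-unit , p∈U , (i , j) , (2∣i , 2∣j , 1+i<N , 1+j<N) , U~ij , (i≤x+a , x+a≤1+i , j≤y , y≤1+j))
    with ≤⇒∃[o]n≡o+m (a≤corner 2∣i x+a≤1+i)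
  ... | z , refl =
    U , U-unit , p∈U , (z , j) ,
    (∣m+n∣m⇒∣n (subst (2 ∣_) (+-comm z a) 2∣i) 2∣a , 2∣j , ≤-<-trans (s≤s (m≤m+n z a)) 1+i<N , 1+j<N) ,
    unitEquiv-∸a U~ij ,
    (+-cancelʳ-≤ a z x i≤x+a , +-cancelʳ-≤ a x (suc z) x+a≤1+i , mate-inUnit 2∣j j≤y y≤1+j)

  level⇒inGrid : Level a p v → InGrid a v
  level⇒inGrid = inUnion⇒inGrid ∘ reach-target

  level-stepʳ : Level a p (x , y) → x + a < N a → Level a p (x + a , mate y)
  level-stepʳ {x = x} {y} lv x+a<N =
    step lv V∈ (level⇒inGrid lv , inUnion⇒inGrid V∈ , inj₁ (∣m-m+n∣≡n x a , ∣n-mate[n]∣≡1 y))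
    where V∈ = inUnion-stepʳ (reach-target lv) x+a<N

  level-stepˡ : Level a p (x + a , y) → Level a p (x , mate y)
  level-stepˡ {x = x} {y} lv =
    step lv V∈ (level⇒inGrid lv , inUnion⇒inGrid V∈ , inj₁ (dx , ∣n-mate[n]∣≡1 y))
    where
      V∈ = inUnion-stepˡ (reach-target lv)
      dx : ∣ x + a - x ∣ ≡ a
      dx = trans (∣-∣-comm (x + a) x) (∣m-m+n∣≡n x a)

  inUnion-swap : InUnion a p v → InUnion a (swap p) (swap v)
  inUnion-swap (U , (2∣i , 2∣j , 1+i<N , 1+j<N) , (i≤x , x≤1+i , j≤y , y≤1+j) ,
                U' , (2∣i' , 2∣j' , 1+i'<N , 1+j'<N) , (k , l , i'≡ , j'≡) , (i'≤x' , x'≤1+i' , j'≤y' , y'≤1+j')) =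
    swap U , (2∣j , 2∣i , 1+j<N , 1+i<N) , (j≤y , y≤1+j , i≤x , x≤1+i) ,
    swap U' , (2∣j' , 2∣i' , 1+j'<N , 1+i'<N) , (l , k , j'≡ , i'≡) , (j'≤y' , y'≤1+j' , i'≤x' , x'≤1+i')

  level-swap : Level a p v → Level a (swap p) (swap v)
  level-swap = reach-swap inUnion-swap

  level-stepᵘ : Level a p (x , y) → y + a < N a → Level a p (mate x , y + a)
  level-stepᵘ lv y+a<N = level-swap (level-stepʳ (level-swap lv) y+a<N)

  level-stepᵈ : Level a p (x , y + a) → Level a p (mate x , y)
  level-stepᵈ lv = level-swap (level-stepˡ (level-swap lv))

  level-shiftʳ : Level a p (x , y) → x + 2 * a < N a → Level a p (x + 2 * a , y)
  level-shiftʳ {p = p} {x} {y} lv x+2a<N =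
    subst (Level a p) (cong₂ _,_ (sym (x+2a≡x+a+a x)) (mate-involutive y))
          (level-stepʳ (level-stepʳ lv x+a<N) x+a+a<N)
    where
      x+a+a<N : x + a + a < N a
      x+a+a<N = subst (_< N a) (x+2a≡x+a+a x) x+2a<N
      x+a<N : x + a < N a
      x+a<N = ≤-<-trans (m≤m+n (x + a) a) x+a+a<N

  level-shiftˡ : Level a p (x + 2 * a , y) → Level a p (x , y)
  level-shiftˡ {p = p} {x} {y} lv =
    subst (λ t → Level a p (x , t)) (mate-involutive y)
          (level-stepˡ (level-stepˡ (subst (λ t → Level a p (t , y)) (x+2a≡x+a+a x) lv)))

  Link : Pt → Pt → ℕ → ℕ → Pt → Pt → Set
  Link p q d e (x , y) (x' , y') =
    Level a p (x , y) × Level a q (x' , y') × ∣ x - x' ∣ ≡ d × ∣ y - y' ∣ ≡ e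

  link-swap : Link p q d e V V' → Link (swap p) (swap q) e d (swap V) (swap V')
  link-swap (lv , lv' , dx , dy) = level-swap lv , level-swap lv' , dy , dx

  link-shiftʳ : Link p q d e (x , y) (x' , y') → x + 2 * a < N a → x' + 2 * a < N a →
                Link p q d e (x + 2 * a , y) (x' + 2 * a , y')
  link-shiftʳ {x = x} {x' = x'} (lv , lv' , dx , dy) x+2a<N x'+2a<N =
    level-shiftʳ lv x+2a<N , level-shiftʳ lv' x'+2a<N , trans (∣m+o-n+o∣≡∣m-n∣ x x' (2 * a)) dx , dy

  link-shiftˡ : Link p q d e (x + 2 * a , y) (x' + 2 * a , y') → Link p q d e (x , y) (x' , y')
  link-shiftˡ {x = x} {x' = x'} (lv , lv' , dx , dy) =
    level-shiftˡ lv , level-shiftˡ lv' , trans (sym (∣m+o-n+o∣≡∣m-n∣ x x' (2 * a))) dx , dy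

  link-stepᵘ : Link p q a e (x , y) (x' , y') → y + a < N a → y' + a < N a →
               Link p q a e (mate x , y + a) (mate x' , y' + a)
  link-stepᵘ {x = x} {y = y} {x' = x'} {y' = y'} (lv , lv' , dx , dy) y+a<N y'+a<N =
    level-stepᵘ lv y+a<N , level-stepᵘ lv' y'+a<N ,
    mate-preserves-even-∣-∣ {m = x} {n = x'} 2∣a dx , trans (∣m+o-n+o∣≡∣m-n∣ y y' a) dy

  link-stepᵈ : Link p q a e (x , y + a) (x' , y' + a) → Link p q a e (mate x , y) (mate x' , y')
  link-stepᵈ {x = x} {y = y} {x' = x'} {y' = y'} (lv , lv' , dx , dy) =
    level-stepᵈ lv , level-stepᵈ lv' ,
    mate-preserves-even-∣-∣ {m = x} {n = x'} 2∣a dx , trans (sym (∣m+o-n+o∣≡∣m-n∣ y y' a)) dy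

  -- The coordinate range [2a, 4a) of the T-region.
  InWindow : ℕ → Set
  InWindow x = 2 * a ≤ x × x < 4 * a

  LinkInWindow : Pt → Pt → ℕ → ℕ → ℕ → ℕ → Set
  LinkInWindow p q d e y y' = ∃₂ λ x x' → InWindow x × Link p q d e (x , y) (x' , y')

  window-from-below : d ≤ a → x < 2 * a → Link p q d e (x , y) (x' , y') → LinkInWindow p q d e y y'
  window-from-below {x = x} {x' = x'} d≤a x<2a l@(_ , _ , dx , _) =
    x + 2 * a , x' + 2 * a , (m≤n+m (2 * a) x , x+2a<4a) ,
    link-shiftʳ l (<-trans x+2a<4a (k*a<N (m≤m+n 4 2))) x'+2a<N
    where
      open ≤-Reasoning
      x+2a<4a : x + 2 * a < 4 * a
      x+2a<4a = subst (x + 2 * a <_) (sym (*-distribʳ-+ a 2 2)) (+-monoˡ-< (2 * a) x<2a)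
      x'+2a<N : x' + 2 * a < N a
      x'+2a<N = begin-strict
        x' + 2 * a         ≤⟨ +-monoˡ-≤ (2 * a) (≤-trans (∣m-n∣≡o⇒n≤m+o dx) (+-monoʳ-≤ x d≤a)) ⟩
        x + a + 2 * a      <⟨ +-monoˡ-< (2 * a) (subst (x + a <_) (+-comm (2 * a) a) (+-monoˡ-< a x<2a)) ⟩
        3 * a + 2 * a      ≡⟨ *-distribʳ-+ a 3 2 ⟨
        5 * a              <⟨ k*a<N (m≤m+n 5 1) ⟩
        N a                ∎

  window-from-above : 0 < a → d ≤ a → Acc _<_ x → 2 * a ≤ x → Link p q d e (x , y) (x' , y') →
                      LinkInWindow p q d e y y'
  window-from-above {x = x} {x' = x'} 0<a d≤a (acc smaller) 2a≤x l@(_ , _ , dx , _) with x <? 4 * a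
  ... | yes x<4a = x , x' , (2a≤x , x<4a) , l
  ... | no x≮4a with ≤⇒∃[o]n≡o+m 2a≤x | ≤⇒∃[o]n≡o+m 2a≤x'
    where
      x≤x'+a : x ≤ x' + a
      x≤x'+a = ≤-trans (∣m-n∣≡o⇒n≤m+o (trans (∣-∣-comm x' x) dx)) (+-monoʳ-≤ x' d≤a)
      2a≤x' : 2 * a ≤ x'
      2a≤x' = ≤-trans (*-monoˡ-≤ a (m≤m+n 2 1))
        (+-cancelʳ-≤ a (3 * a) x' (subst (_≤ x' + a) (+-comm a (3 * a)) (≤-trans (≮⇒≥ x≮4a) x≤x'+a)))
  ... | z , refl | z' , refl =
    window-from-above 0<a d≤a (smaller (m<m+n z (≤-trans 0<a (m≤m+n a _)))) 2a≤z (link-shiftˡ {x = z} {x' = z'} l)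
    where
      2a≤z : 2 * a ≤ z
      2a≤z = +-cancelʳ-≤ (2 * a) (2 * a) z (subst (_≤ z + 2 * a) (*-distribʳ-+ a 2 2) (≮⇒≥ x≮4a))

  into-window : 0 < a → d ≤ a → Link p q d e (x , y) (x' , y') → LinkInWindow p q d e y y'
  into-window {x = x} 0<a d≤a l with x <? 2 * a
  ... | yes x<2a = window-from-below d≤a x<2a l
  ... | no x≮2a  = window-from-above 0<a d≤a (<-wellFounded x) (≮⇒≥ x≮2a) l

  record InBand (k x : ℕ) : Set where
    constructor band
    field
      lower : k * a ≤ x
      upper : x < suc k * a

  window-band : InWindow x → ∃ λ k → (k ≡ 2 ⊎ k ≡ 3) × InBand k x
  window-band {x} (2a≤x , x<4a) with x <? 3 * a
  ... | yes x<3a = 2 , inj₁ refl , band 2a≤x x<3a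
  ... | no x≮3a  = 3 , inj₂ refl , band (≮⇒≥ x≮3a) x<4a

  band-mate : InBand k x → InBand k (mate x)
  band-mate {k} (band lo hi) = band (even≤⇒≤mate (∣n⇒∣m*n k 2∣a) lo) (<even⇒mate< (∣n⇒∣m*n (suc k) 2∣a) hi)

  band-+a : InBand k x → InBand (suc k) (x + a)
  band-+a {k} {x} (band lo hi) = band
    (subst (suc k * a ≤_) (+-comm a x) (+-monoʳ-≤ a lo))
    (subst (_< suc (suc k) * a) (+-comm a x) (+-monoʳ-< a hi))

  band-+a⁻¹ : InBand (suc k) (x + a) → InBand k x
  band-+a⁻¹ {k} {x} (band lo hi) = band
    (+-cancelˡ-≤ a (k * a) x (subst (suc k * a ≤_) (+-comm x a) lo))
    (+-cancelˡ-< a x (suc k * a) (subst (_< suc (suc k) * a) (+-comm x a) hi))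

  HorizontalLift : Pt → Pt → Pt → Set
  HorizontalLift p q (i , j) = ∃₂ λ V V' → Link p q a 1 V V' × InBand i (proj₁ V) × InBand j (proj₂ V)

  horizontalLift⇒lift : HorizontalLift p q B → IsLift a p q B
  horizontalLift⇒lift (V , V' , (lv , lv' , dx , dy) , band x-lo x-hi , band y-lo y-hi) =
    V , V' , lv , lv' , (level⇒inGrid lv , level⇒inGrid lv' , inj₁ (dx , dy)) ,
    (level⇒inGrid lv , x-lo , x-hi , y-lo , y-hi)

  horizontalLift-up : suc (suc j) * a < N a → HorizontalLift p q (i , j) → HorizontalLift p q (i , suc j)
  horizontalLift-up {j} 2+j<N ((x , y) , (x' , y') , l@(_ , _ , _ , dy) , x∈ , y∈) =
    _ , _ , link-stepᵘ l (<-trans (InBand.upper y+a∈) 2+j<N) y'+a<N , band-mate x∈ , y+a∈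
    where
      y+a∈ = band-+a y∈
      y'≤1+j*a : y' ≤ suc j * a
      y'≤1+j*a = ≤-trans (∣m-n∣≡o⇒n≤m+o dy) (subst (_≤ suc j * a) (+-comm 1 y) (InBand.upper y∈))
      y'+a<N : y' + a < N a
      y'+a<N = ≤-<-trans (subst (y' + a ≤_) (+-comm (suc j * a) a) (+-monoˡ-≤ a y'≤1+j*a)) 2+j<N

  horizontalLift-down : 0 < a → 0 < j → HorizontalLift p q (i , suc j) → HorizontalLift p q (i , j)
  horizontalLift-down {j} 0<a 0<j ((x , y) , (x' , y') , l@(_ , _ , _ , dy) , x∈ , y∈)
    with ≤⇒∃[o]n≡o+m (≤-trans (m≤m+n a 1) a+1≤y) | ≤⇒∃[o]n≡o+m a≤y'
    where
      a+1≤y : a + 1 ≤ y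
      a+1≤y = ≤-trans (+-monoʳ-≤ a (*-mono-< 0<j 0<a)) (InBand.lower y∈)
      a≤y' : a ≤ y'
      a≤y' = +-cancelʳ-≤ 1 a y' (≤-trans a+1≤y (∣m-n∣≡o⇒n≤m+o (trans (∣-∣-comm y' y) dy)))
  ... | w , refl | w' , refl = _ , _ , link-stepᵈ l , band-mate x∈ , band-+a⁻¹ y∈

  GrayAndWhiteLifts : Pt → Pt → Set
  GrayAndWhiteLifts p q =
    (∃[ B ] (InT B × Gray B × IsLift a p q B)) × (∃[ B ] (InT B × White B × IsLift a p q B))

  column-lifts : i ≡ 2 ⊎ i ≡ 3 → IsLift a p q (i , 2) → IsLift a p q (i , 3) → GrayAndWhiteLifts p q
  column-lifts (inj₁ refl) lift₂ lift₃ =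
    ((2 , 2) , (inj₁ refl , inj₁ refl) , divides 2 refl , lift₂) ,
    ((2 , 3) , (inj₁ refl , inj₂ refl) , 2∤1+n (divides 2 refl) , lift₃)
  column-lifts (inj₂ refl) lift₂ lift₃ =
    ((3 , 3) , (inj₂ refl , inj₂ refl) , divides 3 refl , lift₃) ,
    ((3 , 2) , (inj₂ refl , inj₁ refl) , 2∤1+n (divides 2 refl) , lift₂)

  window-link⇒lifts : 0 < a → InWindow x → InWindow y → Link p q a 1 (x , y) (x' , y') → GrayAndWhiteLifts p q
  window-link⇒lifts {p = p} {q = q} 0<a x∈ y∈ l with window-band x∈ | window-band y∈
  ... | i , i∈ , x-band | _ , inj₁ refl , y-band =
    column-lifts i∈ (horizontalLift⇒lift lift₂) (horizontalLift⇒lift (horizontalLift-up (k*a<N (m≤m+n 4 2)) lift₂))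
    where
      lift₂ : HorizontalLift p q (i , 2)
      lift₂ = _ , _ , l , x-band , y-band
  ... | i , i∈ , x-band | _ , inj₂ refl , y-band =
    column-lifts i∈ (horizontalLift⇒lift (horizontalLift-down 0<a z<s lift₃)) (horizontalLift⇒lift lift₃)
    where
      lift₃ : HorizontalLift p q (i , 3)
      lift₃ = _ , _ , l , x-band , y-band

  horizontal-link⇒lifts : 0 < a → Link p q a 1 (x , y) (x' , y') → GrayAndWhiteLifts p q
  horizontal-link⇒lifts 0<a l with into-window 0<a ≤-refl l
  ... | x₀ , x₀' , x₀∈ , l₁ with into-window 0<a 0<a (link-swap l₁)
  ... | y₀ , y₀' , y₀∈ , l₂ = window-link⇒lifts 0<a x₀∈ y₀∈ (link-swap l₂)

  inBlock-swap : InBlock a B V → InBlock a (swap B) (swap V)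
  inBlock-swap (V∈ , x-lo , x-hi , y-lo , y-hi) = swap V∈ , y-lo , y-hi , x-lo , x-hi

  lift-swap : IsLift a p q B → IsLift a (swap p) (swap q) (swap B)
  lift-swap {B = B} (V , V' , lv , lv' , VV' , V∈B) =
    swap V , swap V' , level-swap lv , level-swap lv' , knight-swap VV' , inBlock-swap {B = B} V∈B

  grayAndWhiteLifts-swap : GrayAndWhiteLifts (swap p) (swap q) → GrayAndWhiteLifts p q
  grayAndWhiteLifts-swap ((B , B∈T , gray , lift) , (B' , B'∈T , white , lift')) =
    (swap B , swap B∈T , subst (2 ∣_) (+-comm (proj₁ B) (proj₂ B)) gray , lift-swap {B = B} lift) ,
    (swap B' , swap B'∈T , white ∘ subst (2 ∣_) (+-comm (proj₂ B') (proj₁ B')) , lift-swap {B = B'} lift')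

-- The level-index and distinctness hypotheses are not needed.
lemma8 : (a : ℕ) → 2 ∣ a → 0 < a →
    (p q : Pt) → IsLevelIndex a p → IsLevelIndex a q →
    ¬ SameLevel a p q → LevelsAdjacent a p q →
    (∃[ B ] (InT B × Gray B × IsLift a p q B)) ×
    (∃[ B ] (InT B × White B × IsLift a p q B))
lemma8 a 2∣a 0<a p q _ _ _ ((x , y) , (x' , y') , lv , lv' , _ , _ , inj₁ (dx , dy)) =
  horizontal-link⇒lifts a 2∣a 0<a (lv , lv' , dx , dy)
lemma8 a 2∣a 0<a p q _ _ _ ((x , y) , (x' , y') , lv , lv' , _ , _ , inj₂ (dx , dy)) =
  grayAndWhiteLifts-swap a 2∣a (horizontal-link⇒lifts a 2∣a 0<a (link-swap a 2∣a (lv , lv' , dx , dy)))
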